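{- For each $p\in\beta\mathbb N$, $$[p]_{LN}=\{mr: m\in\mathbb N,\ r\in\beta\mathbb N,\ \exists n\in\mathbb N\,(r\mid_L p\ \wedge\ p\mid_L nr)\}.$$
   Context: $\mathbb N=\{1,2,\dots\}$; $\beta\mathbb N$ is the set of ultrafilters on $\mathbb N$ (principal ultrafilters identified with elements of $\mathbb N$), with multiplication: $A\in p\cdot q$ iff $\{n: A/n\in q\}\in p$, where $A/n=\{a/n:a\in A,\ n\mid a\}$. $p\mid_L q$ iff $q=xp$ for some $x\in\beta\mathbb N$. $p\mid_{LN}q$ iff there is $n\in\mathbb N$ with $p\mid_L nq$. $[p]_{LN}=\{q: p\mid_{LN}q\text{ and }q\mid_{LN}p\}$. -}

module Defs where

open import Data.Nat using (ℕ; _*_; NonZero)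
open import Data.Product using (Σ; _×_; _,_)
open import Data.Sum using (_⊎_)
open import Data.Empty using (⊥)
open import Relation.Nullary using (¬_)

-- The paper's ℕ = {1,2,...}; we work in Agda's ℕ
-- and require every ultrafilter to contain the set of positive numbers,
-- so ultrafilters here are exactly the ultrafilters on {1,2,...}.
Subset : Set₁
Subset = ℕ → Set

_/ˢ_ : Subset → ℕ → Subset
(A /ˢ n) m = NonZero m × A (n * m)

MemPred : Set₁
MemPred = Subset → Set

record Ultrafilter : Set₁ where
  field
    mem      : MemPred
    up       : ∀ {A B : Subset} → (∀ k → A k → B k) → mem A → mem B
    inter    : ∀ {A B : Subset} → mem A → mem B → mem (λ k → A k × B k)
    proper   : ¬ mem (λ _ → ⊥)
    ultra    : ∀ (A : Subset) → mem A ⊎ mem (λ k → ¬ A k)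
    positive : mem NonZero
open Ultrafilter public

_·ₘ_ : MemPred → MemPred → MemPred
(P ·ₘ Q) A = P (λ n → Q (A /ˢ n))

principal : ℕ → MemPred
principal n A = A n

_≐_ : MemPred → MemPred → Set₁
P ≐ Q = ∀ (A : Subset) → (P A → Q A) × (Q A → P A)

_∣L_ : MemPred → MemPred → Set₁
P ∣L Q = Σ Ultrafilter λ x → Q ≐ (mem x ·ₘ P)

_∣LN_ : MemPred → MemPred → Set₁
P ∣LN Q = Σ ℕ λ n → NonZero n × (P ∣L (principal n ·ₘ Q))

_∈[_]LN : Ultrafilter → Ultrafilter → Set₁
q ∈[ p ]LN = (mem p ∣LN mem q) × (mem q ∣LN mem p)

InRHS : Ultrafilter → Ultrafilter → Set₁
InRHS p q =
  Σ ℕ λ m → NonZero m ×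
  Σ Ultrafilter λ r →
  Σ ℕ λ n → NonZero n ×
    (mem r ∣L mem p) × (mem p ∣L (principal n ·ₘ mem r)) ×
    (mem q ≐ (principal m ·ₘ mem r))

-- Multiplying an ultrafilter by a principal one on either side is the pushforward along
-- j ↦ n j, so principal ultrafilters are central, cancellable on the left, and every
-- ultrafilter concentrated on the multiples of n is n times another one.  If a q = x p
-- and b p = y q, then, since b ∣ j i for y-almost all j and q-almost all i, pigeonholing
-- gcd(i, b) gives one d with d ∣ i for q-almost all i and b ∣ j d for y-almost all j.
-- Hence q = d r, a d r = x p, and b p = y d r = b w r, so p = w r.  Conversely, if
-- q = m r, p = z r and n r = x p, then m p = z q and n q = m n r = m x p.
module Submission where

open import Defs
open import Data.Empty using (⊥-elim)
open import Data.Nat using (ℕ; suc; _*_; _/_; _<_; s≤s; s≤s⁻¹; NonZero; ≢-nonZero; ≢-nonZero⁻¹)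
open import Data.Nat.Properties using (_≟_; *-comm; *-assoc; m*n≢0; m*n≢0⇒n≢0; ≤∧≢⇒<)
open import Data.Nat.Divisibility using (_∣_; _∣?_; n∣m*n; m∣m*n)
open import Data.Nat.DivMod using (m*n/n≡m; m*[n/m]≡n)
open import Data.Nat.GCD using (gcd; gcd-greatest; c*gcd[m,n]≡gcd[cm,cn]; gcd[m,n]≤n; gcd[m,n]∣m; gcd[m,n]≢0)
open import Data.Product using (Σ; _×_; _,_; proj₁; proj₂)
open import Data.Sum using (inj₁; inj₂)
open import Level using (0ℓ) renaming (suc to lsuc)
open import Relation.Binary.Bundles using (Setoid)
open import Relation.Binary.PropositionalEquality using (_≡_; sym; trans; cong; subst)
open import Relation.Nullary using (Dec; yes; no; ¬?)

private variable
  P P′ Q Q′ R : MemPred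
  A : Subset
  b j m n : ℕ

infix 2 _⇔_
_⇔_ : Set → Set → Set
X ⇔ Y = (X → Y) × (Y → X)

≐-setoid : Setoid (lsuc 0ℓ) (lsuc 0ℓ)
≐-setoid = record
  { Carrier       = MemPred
  ; _≈_           = _≐_
  ; isEquivalence = record
    { refl  = λ A → (λ a → a) , (λ a → a)
    ; sym   = λ P≐Q A → proj₂ (P≐Q A) , proj₁ (P≐Q A)
    ; trans = λ P≐Q Q≐R A → (λ a → proj₁ (Q≐R A) (proj₁ (P≐Q A) a))
                          , (λ a → proj₂ (P≐Q A) (proj₂ (Q≐R A) a))
    }
  }

open import Relation.Binary.Reasoning.Setoid ≐-setoid

Monotone⁺ : MemPred → Set₁
Monotone⁺ P = ∀ {A B : Subset} → (∀ k → NonZero k → A k → B k) → P A → P B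

monotone⁺-cong : Monotone⁺ P → {B : Subset} → (∀ k → NonZero k → A k ⇔ B k) → P A ⇔ P B
monotone⁺-cong P↑ A⇔B = P↑ (λ k k≢0 → proj₁ (A⇔B k k≢0)) , P↑ (λ k k≢0 → proj₂ (A⇔B k k≢0))

mem-monotone⁺ : (u : Ultrafilter) → Monotone⁺ (mem u)
mem-monotone⁺ u A⊆B uA = up u (λ k (a , k≢0) → A⊆B k k≢0 a) (inter u uA (positive u))

principal-monotone⁺ : NonZero n → Monotone⁺ (principal n)
principal-monotone⁺ n≢0 A⊆B = A⊆B _ n≢0

·ₘ-monotone⁺ : Monotone⁺ P → Monotone⁺ Q → Monotone⁺ (P ·ₘ Q)
·ₘ-monotone⁺ P↑ Q↑ A⊆B =
  P↑ (λ j j≢0 → Q↑ (λ k k≢0 (_ , a) → k≢0 , A⊆B _ (m*n≢0 j k {{j≢0}} {{k≢0}}) a))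

·ₘ-congˡ : (Q : MemPred) → P ≐ P′ → (P ·ₘ Q) ≐ (P′ ·ₘ Q)
·ₘ-congˡ Q P≐P′ A = P≐P′ (λ n → Q (A /ˢ n))

·ₘ-congʳ : Monotone⁺ P → Q ≐ Q′ → (P ·ₘ Q) ≐ (P ·ₘ Q′)
·ₘ-congʳ P↑ Q≐Q′ A = monotone⁺-cong P↑ (λ n _ → Q≐Q′ (A /ˢ n))

/ˢ-* : NonZero n → ∀ i → (A /ˢ (m * n)) i ⇔ ((A /ˢ m) /ˢ n) i
/ˢ-* {n} {A} {m} n≢0 i =
  (λ (i≢0 , a) → i≢0 , m*n≢0 n i {{n≢0}} {{i≢0}} , subst A (*-assoc m n i) a) ,
  (λ (i≢0 , _ , a) → i≢0 , subst A (sym (*-assoc m n i)) a)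

·ₘ-assoc : Monotone⁺ P → Monotone⁺ Q → Monotone⁺ R → ((P ·ₘ Q) ·ₘ R) ≐ (P ·ₘ (Q ·ₘ R))
·ₘ-assoc P↑ Q↑ R↑ A = monotone⁺-cong P↑ λ j _ → monotone⁺-cong Q↑ λ k k≢0 →
  (λ (_ , a) → proj₁ (monotone⁺-cong R↑ (λ i _ → /ˢ-* {A = A} {j} k≢0 i)) a) ,
  (λ a → k≢0 , proj₂ (monotone⁺-cong R↑ (λ i _ → /ˢ-* {A = A} {j} k≢0 i)) a)

principal-·ₘ-comm : NonZero n → Monotone⁺ P → (principal n ·ₘ P) ≐ (P ·ₘ principal n)
principal-·ₘ-comm {n} n≢0 P↑ A = monotone⁺-cong P↑ λ j j≢0 →
  (λ (_ , a) → n≢0 , subst A (*-comm n j) a) , (λ (_ , a) → j≢0 , subst A (*-comm j n) a)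

principal-·ₘ-principal : NonZero n → (principal m ·ₘ principal n) ≐ principal (m * n)
principal-·ₘ-principal n≢0 A = proj₂ , (n≢0 ,_)

n*m/n≡m : ∀ n m .{{_ : NonZero n}} → n * m / n ≡ m
n*m/n≡m n m = trans (cong (_/ n) (*-comm n m)) (m*n/n≡m m n)

principal-·ₘ-cancel : NonZero n → Monotone⁺ P → Monotone⁺ Q →
                      (principal n ·ₘ P) ≐ (principal n ·ₘ Q) → P ≐ Q
principal-·ₘ-cancel {n} n≢0 P↑ Q↑ nP≐nQ A =
  (λ pA → from Q↑ (proj₁ (nP≐nQ A/n) (to P↑ pA))) ,
  (λ qA → from P↑ (proj₂ (nP≐nQ A/n) (to Q↑ qA)))
  where
  instance _ = n≢0
  A/n : Subset
  A/n i = A (i / n)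
  A⇔A/n/n : ∀ k → NonZero k → A k ⇔ (A/n /ˢ n) k
  A⇔A/n/n k k≢0 = (λ a → k≢0 , subst A (sym (n*m/n≡m n k)) a) ,
                  (λ (_ , a) → subst A (n*m/n≡m n k) a)
  to : Monotone⁺ P′ → P′ A → P′ (A/n /ˢ n)
  to P′↑ = proj₁ (monotone⁺-cong P′↑ A⇔A/n/n)
  from : Monotone⁺ P′ → P′ (A/n /ˢ n) → P′ A
  from P′↑ = proj₂ (monotone⁺-cong P′↑ A⇔A/n/n)

principal-·ₘ-multiples : (u : Ultrafilter) → (principal n ·ₘ mem u) (n ∣_)
principal-·ₘ-multiples u = up u (λ k k≢0 → k≢0 , m∣m*n k) (positive u)

pushforward : (f : ℕ → ℕ) (u : Ultrafilter) → mem u (λ j → NonZero (f j)) → Ultrafilter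
pushforward f u fu≢0 = record
  { mem      = λ A → mem u (λ j → A (f j))
  ; up       = λ A⊆B → up u (λ j → A⊆B (f j))
  ; inter    = inter u
  ; proper   = proper u
  ; ultra    = λ A → ultra u (λ j → A (f j))
  ; positive = fu≢0
  }

·ₘ-principal-ultrafilter : NonZero n → (u : Ultrafilter) →
                           Σ Ultrafilter λ v → mem v ≐ (mem u ·ₘ principal n)
·ₘ-principal-ultrafilter {n} n≢0 u =
  pushforward (_* n) u (mem-monotone⁺ u (λ j j≢0 _ → m*n≢0 j n {{j≢0}} {{n≢0}}) (positive u)) ,
  λ A → up u (λ j → n≢0 ,_) , up u (λ j → proj₂)

principal-·ₘ-quotient : NonZero n → (u : Ultrafilter) → mem u (n ∣_) →
                        Σ Ultrafilter λ v → mem u ≐ (principal n ·ₘ mem v)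
principal-·ₘ-quotient {n} n≢0 u u-n∣ = pushforward (_/ n) u u-i/n≢0 , u≐n[u/n]
  where
  instance _ = n≢0
  u-i/n≢0 : mem u (λ i → NonZero (i / n))
  u-i/n≢0 = mem-monotone⁺ u (λ i i≢0 n∣i → m*n≢0⇒n≢0 n {{subst NonZero (sym (m*[n/m]≡n n∣i)) i≢0}}) u-n∣
  u≐n[u/n] : mem u ≐ (principal n ·ₘ mem (pushforward (_/ n) u u-i/n≢0))
  u≐n[u/n] A =
    (λ uA → up u (λ i ((a , n∣i) , i/n≢0) → i/n≢0 , subst A (sym (m*[n/m]≡n n∣i)) a)
                 (inter u (inter u uA u-n∣) u-i/n≢0)) ,
    (λ u-A[n[i/n]] → up u (λ i ((_ , a) , n∣i) → subst A (m*[n/m]≡n n∣i) a) (inter u u-A[n[i/n]] u-n∣))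

pigeonhole : (u : Ultrafilter) (f : ℕ → ℕ) (N : ℕ) → mem u (λ j → f j < N) →
             Σ ℕ λ m → mem u (λ j → f j ≡ m)
pigeonhole u f 0 u-f<0 = ⊥-elim (proper u (up u (λ j ()) u-f<0))
pigeonhole u f (suc N) u-f<N+1 with ultra u (λ j → f j ≡ N)
... | inj₁ u-f≡N = N , u-f≡N
... | inj₂ u-f≢N = pigeonhole u f N
  (up u (λ j (f<N+1 , f≢N) → ≤∧≢⇒< (s≤s⁻¹ f<N+1) f≢N) (inter u u-f<N+1 u-f≢N))

-- Sets in an ultrafilter are inhabited; constructively this yields only decidable conclusions.
mem-Dec-consequence : (u : Ultrafilter) {C : Set} → Dec C → (∀ i → A i → C) → mem u A → C
mem-Dec-consequence u (yes c) _   _  = c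
mem-Dec-consequence u (no ¬c) A⇒C uA = ⊥-elim (proper u (up u (λ i a → ¬c (A⇒C i a)) uA))

∣-*-gcd : ∀ {i} → b ∣ j * i → b ∣ j * gcd i b
∣-*-gcd {b} {j} {i} b∣ji =
  subst (b ∣_) (sym (c*gcd[m,n]≡gcd[cm,cn] j i b)) (gcd-greatest b∣ji (n∣m*n j))

common-divisor : NonZero b → (y q : Ultrafilter) → mem y (λ j → mem q (λ i → b ∣ j * i)) →
                 Σ ℕ λ d → NonZero d × mem q (d ∣_) × mem y (λ j → b ∣ j * d)
common-divisor {b} b≢0 y q y-q-b∣ = g , g≢0 , q-g∣ , y-b∣jg
  where
  instance _ = b≢0
  gcd-constant : Σ ℕ λ g → mem q (λ i → gcd i b ≡ g)
  gcd-constant = pigeonhole q (λ i → gcd i b) (suc b) (up q (λ i _ → s≤s (gcd[m,n]≤n i b)) (positive q))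
  g : ℕ
  g = proj₁ gcd-constant
  q-gcd≡g : mem q (λ i → gcd i b ≡ g)
  q-gcd≡g = proj₂ gcd-constant
  g≢0 : NonZero g
  g≢0 = ≢-nonZero (mem-Dec-consequence q (¬? (g ≟ 0))
          (λ i gcd≡g g≡0 → gcd[m,n]≢0 i b (inj₂ (≢-nonZero⁻¹ b)) (trans gcd≡g g≡0)) q-gcd≡g)
  q-g∣ : mem q (g ∣_)
  q-g∣ = up q (λ i gcd≡g → subst (_∣ i) gcd≡g (gcd[m,n]∣m i b)) q-gcd≡g
  y-b∣jg : mem y (λ j → b ∣ j * g)
  y-b∣jg = up y (λ j q-b∣j* → mem-Dec-consequence q (b ∣? j * g)
             (λ i (b∣ji , gcd≡g) → subst (λ d → b ∣ j * d) gcd≡g (∣-*-gcd {j = j} {i} b∣ji))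
             (inter q q-b∣j* q-gcd≡g)) y-q-b∣

forward : (p q : Ultrafilter) → q ∈[ p ]LN → InRHS p q
forward p q ((a , a≢0 , x , aq≐xp) , (b , b≢0 , y , bp≐yq)) =
  d , d≢0 , r , a * d , m*n≢0 a d {{a≢0}} {{d≢0}} , (w , p≐wr) , (x , adr≐xp) , q≐dr
  where
  y-q-b∣ : mem y (λ j → mem q (λ i → b ∣ j * i))
  y-q-b∣ = up y (λ j → up q (λ i → proj₂)) (proj₁ (bp≐yq (b ∣_)) (principal-·ₘ-multiples p))
  divisor : Σ ℕ λ d → NonZero d × mem q (d ∣_) × mem y (λ j → b ∣ j * d)
  divisor = common-divisor b≢0 y q y-q-b∣
  d : ℕ
  d = proj₁ divisor
  d≢0 : NonZero d
  d≢0 = proj₁ (proj₂ divisor)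
  quotient-q : Σ Ultrafilter λ r → mem q ≐ (principal d ·ₘ mem r)
  quotient-q = principal-·ₘ-quotient d≢0 q (proj₁ (proj₂ (proj₂ divisor)))
  r : Ultrafilter
  r = proj₁ quotient-q
  q≐dr : mem q ≐ (principal d ·ₘ mem r)
  q≐dr = proj₂ quotient-q
  yd : Σ Ultrafilter λ v → mem v ≐ (mem y ·ₘ principal d)
  yd = ·ₘ-principal-ultrafilter d≢0 y
  v : Ultrafilter
  v = proj₁ yd
  v≐yd : mem v ≐ (mem y ·ₘ principal d)
  v≐yd = proj₂ yd
  v-b∣ : mem v (b ∣_)
  v-b∣ = proj₂ (v≐yd (b ∣_)) (up y (λ j → d≢0 ,_) (proj₂ (proj₂ (proj₂ divisor))))
  quotient-v : Σ Ultrafilter λ w → mem v ≐ (principal b ·ₘ mem w)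
  quotient-v = principal-·ₘ-quotient b≢0 v v-b∣
  w : Ultrafilter
  w = proj₁ quotient-v
  v≐bw : mem v ≐ (principal b ·ₘ mem w)
  v≐bw = proj₂ quotient-v
  ↑ : (u : Ultrafilter) → Monotone⁺ (mem u)
  ↑ = mem-monotone⁺
  adr≐xp : (principal (a * d) ·ₘ mem r) ≐ (mem x ·ₘ mem p)
  adr≐xp = begin
    principal (a * d) ·ₘ mem r               ≈⟨ ·ₘ-congˡ (mem r) (principal-·ₘ-principal {m = a} d≢0) ⟨
    (principal a ·ₘ principal d) ·ₘ mem r    ≈⟨ ·ₘ-assoc (principal-monotone⁺ a≢0) (principal-monotone⁺ d≢0) (↑ r) ⟩
    principal a ·ₘ (principal d ·ₘ mem r)    ≈⟨ ·ₘ-congʳ (principal-monotone⁺ a≢0) q≐dr ⟨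
    principal a ·ₘ mem q                     ≈⟨ aq≐xp ⟩
    mem x ·ₘ mem p                           ∎
  bp≐bwr : (principal b ·ₘ mem p) ≐ (principal b ·ₘ (mem w ·ₘ mem r))
  bp≐bwr = begin
    principal b ·ₘ mem p                     ≈⟨ bp≐yq ⟩
    mem y ·ₘ mem q                           ≈⟨ ·ₘ-congʳ (↑ y) q≐dr ⟩
    mem y ·ₘ (principal d ·ₘ mem r)          ≈⟨ ·ₘ-assoc (↑ y) (principal-monotone⁺ d≢0) (↑ r) ⟨
    (mem y ·ₘ principal d) ·ₘ mem r          ≈⟨ ·ₘ-congˡ (mem r) v≐yd ⟨
    mem v ·ₘ mem r                           ≈⟨ ·ₘ-congˡ (mem r) v≐bw ⟩
    (principal b ·ₘ mem w) ·ₘ mem r          ≈⟨ ·ₘ-assoc (principal-monotone⁺ b≢0) (↑ w) (↑ r) ⟩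
    principal b ·ₘ (mem w ·ₘ mem r)          ∎
  p≐wr : mem p ≐ (mem w ·ₘ mem r)
  p≐wr = principal-·ₘ-cancel b≢0 (↑ p) (·ₘ-monotone⁺ (↑ w) (↑ r)) bp≐bwr

backward : (p q : Ultrafilter) → InRHS p q → q ∈[ p ]LN
backward p q (m , m≢0 , r , n , n≢0 , (z , p≐zr) , (x , nr≐xp) , q≐mr) =
  (n , n≢0 , u , nq≐up) , (m , m≢0 , z , mp≐zq)
  where
  u : Ultrafilter
  u = proj₁ (·ₘ-principal-ultrafilter m≢0 x)
  u≐xm : mem u ≐ (mem x ·ₘ principal m)
  u≐xm = proj₂ (·ₘ-principal-ultrafilter m≢0 x)
  ↑ : (u : Ultrafilter) → Monotone⁺ (mem u)
  ↑ = mem-monotone⁺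
  m↑ : Monotone⁺ (principal m)
  m↑ = principal-monotone⁺ m≢0
  n↑ : Monotone⁺ (principal n)
  n↑ = principal-monotone⁺ n≢0
  nq≐up : (principal n ·ₘ mem q) ≐ (mem u ·ₘ mem p)
  nq≐up = begin
    principal n ·ₘ mem q                     ≈⟨ ·ₘ-congʳ n↑ q≐mr ⟩
    principal n ·ₘ (principal m ·ₘ mem r)    ≈⟨ ·ₘ-assoc n↑ m↑ (↑ r) ⟨
    (principal n ·ₘ principal m) ·ₘ mem r    ≈⟨ ·ₘ-congˡ (mem r) (principal-·ₘ-comm m≢0 n↑) ⟨
    (principal m ·ₘ principal n) ·ₘ mem r    ≈⟨ ·ₘ-assoc m↑ n↑ (↑ r) ⟩
    principal m ·ₘ (principal n ·ₘ mem r)    ≈⟨ ·ₘ-congʳ m↑ nr≐xp ⟩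
    principal m ·ₘ (mem x ·ₘ mem p)          ≈⟨ ·ₘ-assoc m↑ (↑ x) (↑ p) ⟨
    (principal m ·ₘ mem x) ·ₘ mem p          ≈⟨ ·ₘ-congˡ (mem p) (principal-·ₘ-comm m≢0 (↑ x)) ⟩
    (mem x ·ₘ principal m) ·ₘ mem p          ≈⟨ ·ₘ-congˡ (mem p) u≐xm ⟨
    mem u ·ₘ mem p                           ∎
  mp≐zq : (principal m ·ₘ mem p) ≐ (mem z ·ₘ mem q)
  mp≐zq = begin
    principal m ·ₘ mem p                     ≈⟨ ·ₘ-congʳ m↑ p≐zr ⟩
    principal m ·ₘ (mem z ·ₘ mem r)          ≈⟨ ·ₘ-assoc m↑ (↑ z) (↑ r) ⟨
    (principal m ·ₘ mem z) ·ₘ mem r          ≈⟨ ·ₘ-congˡ (mem r) (principal-·ₘ-comm m≢0 (↑ z)) ⟩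
    (mem z ·ₘ principal m) ·ₘ mem r          ≈⟨ ·ₘ-assoc (↑ z) m↑ (↑ r) ⟩
    mem z ·ₘ (principal m ·ₘ mem r)          ≈⟨ ·ₘ-congʳ (↑ z) q≐mr ⟨
    mem z ·ₘ mem q                           ∎

mainTheorem4 : (p q : Ultrafilter) → (q ∈[ p ]LN → InRHS p q) × (InRHS p q → q ∈[ p ]LN)
mainTheorem4 p q = forward p q , backward p q
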